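{- Let $G$ be an abelian group (written additively with $\oplus$, identity $\mathcal O$), and suppose there is an odd positive integer $N$ such that $G[N]\cong(\mathbb Z/N\mathbb Z)\times(\mathbb Z/N\mathbb Z)$. Then the $N^2$ elements of $G[N]$ can be placed in an $N\times N$ grid, one element per cell, such that the sum of the entries of each column and of each row is the identity $\mathcal O$.
   Context: $G[N]=\{P\in G: [N]P=\mathcal O\}$, where $[N]P$ is $P$ added to itself $N$ times. -}

module Defs where

open import Level using (_⊔_)
open import Data.Nat using (ℕ; zero; suc; NonZero)
import Data.Nat as ℕ
open import Data.Nat.DivMod using (_mod_)
open import Data.Fin using (Fin; toℕ)
import Data.Fin as Fin
open import Data.Product using (_×_; _,_; Σ; ∃)
open import Relation.Binary.PropositionalEquality using (_≡_)
open import Algebra.Bundles using (AbelianGroup)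

_+ₘ_ : ∀ {N} .{{_ : NonZero N}} → Fin N → Fin N → Fin N
_+ₘ_ {N} a b = (toℕ a ℕ.+ toℕ b) mod N

_+ₘ²_ : ∀ {N} .{{_ : NonZero N}} → Fin N × Fin N → Fin N × Fin N → Fin N × Fin N
(a , b) +ₘ² (c , d) = (a +ₘ c) , (b +ₘ d)

module _ {c ℓ} (G : AbelianGroup c ℓ) where
  open AbelianGroup G

  mulG : ℕ → Carrier → Carrier
  mulG zero    P = ε
  mulG (suc n) P = P ∙ mulG n P

  InTorsion : ℕ → Carrier → Set ℓ
  InTorsion N P = mulG N P ≈ ε

  sumG : (n : ℕ) → (Fin n → Carrier) → Carrier
  sumG zero    f = ε
  sumG (suc n) f = f Fin.zero ∙ sumG n (λ i → f (Fin.suc i))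

  record TorsionIso (N : ℕ) .{{_ : NonZero N}} : Set (c ⊔ ℓ) where
    field
      φ      : Fin N × Fin N → Carrier
      into   : ∀ x → InTorsion N (φ x)
      hom    : ∀ x y → φ (x +ₘ² y) ≈ φ x ∙ φ y
      inj    : ∀ x y → φ x ≈ φ y → x ≡ y
      surj   : ∀ P → InTorsion N P → ∃ λ x → φ x ≈ P

  record MagicGrid (N : ℕ) : Set (c ⊔ ℓ) where
    field
      cell     : Fin N → Fin N → Carrier
      inG[N]   : ∀ i j → InTorsion N (cell i j)
      covers   : ∀ P → InTorsion N P → Σ (Fin N) λ i → Σ (Fin N) λ j → cell i j ≈ P
      distinct : ∀ i j k l → cell i j ≈ cell k l → (i ≡ k × j ≡ l)
      rowSum   : ∀ i → sumG N (λ j → cell i j) ≈ ε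
      colSum   : ∀ j → sumG N (λ i → cell i j) ≈ ε

module Submission where

-- Let φ : (ℤ/Nℤ)² → G[N] be the given isomorphism and put the
-- element φ(i , j) into cell (i , j) of the N × N grid.  Since φ is a
-- bijection onto G[N], every element of G[N] occurs exactly once.  Since φ
-- is a homomorphism, the sum of row i is φ(N·i , 0 + 1 + ⋯ + (N−1)) and the
-- sum of column j is φ(0 + 1 + ⋯ + (N−1) , N·j).  Now N·i ≡ 0 (mod N), and
-- for odd N = 2m + 1 the triangular number 0 + 1 + ⋯ + (N−1) = m·N is also
-- ≡ 0 (mod N); so every line sums to φ(0 , 0) = 𝒪.

open import Defs
open import Level using (Level)
open import Function using (id; const)
open import Data.Nat using (ℕ; NonZero; zero; suc; _+_; _*_; _%_; _/_)
open import Data.Nat.DivMod using (_mod_; m≡m%n+[m/n]*n; m*n%n≡0; %-distribˡ-+; m%n%n≡m%n)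
open import Data.Nat.Properties using (+-assoc; +-comm; *-comm; +-cancelʳ-≡; *-cancelʳ-≡)
open import Data.Nat.Solver using (module +-*-Solver)
open import Data.Fin using (Fin; toℕ)
import Data.Fin as Fin
open import Data.Fin.Properties using (toℕ-fromℕ<; toℕ-injective)
open import Data.Product using (_×_; _,_; proj₁; proj₂)
open import Relation.Binary.PropositionalEquality
  using (_≡_; refl; sym; trans; cong; cong₂; module ≡-Reasoning)
open import Algebra.Bundles using (AbelianGroup)
import Algebra.Properties.Group as GroupProperties

open +-*-Solver

sumℕ : (n : ℕ) → (Fin n → ℕ) → ℕ
sumℕ zero    f = 0
sumℕ (suc n) f = f Fin.zero + sumℕ n (λ j → f (Fin.suc j))

sumℕ-suc : ∀ n (f : Fin n → ℕ) → sumℕ n (λ j → suc (f j)) ≡ n + sumℕ n f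
sumℕ-suc zero    f = refl
sumℕ-suc (suc n) f = cong suc (begin
    a + sumℕ n (λ j → suc (f (Fin.suc j)))  ≡⟨ cong (a +_) (sumℕ-suc n _) ⟩
    a + (n + s)                             ≡⟨ sym (+-assoc a n s) ⟩
    (a + n) + s                             ≡⟨ cong (_+ s) (+-comm a n) ⟩
    (n + a) + s                             ≡⟨ +-assoc n a s ⟩
    n + (a + s)                             ∎)
  where
  open ≡-Reasoning
  a = f Fin.zero
  s = sumℕ n (λ j → f (Fin.suc j))

sumℕ-const : ∀ n a → sumℕ n (const a) ≡ n * a
sumℕ-const zero    a = refl
sumℕ-const (suc n) a = cong (a +_) (sumℕ-const n a)

triangle : ∀ n → sumℕ n toℕ * 2 + n ≡ n * n
triangle zero    = refl
triangle (suc n) = begin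
    sumℕ n (λ j → suc (toℕ j)) * 2 + suc n
      ≡⟨ cong (λ s → s * 2 + suc n) (sumℕ-suc n toℕ) ⟩
    (n + t) * 2 + suc n
      ≡⟨ solve 2 (λ n t → (n :+ t) :* con 2 :+ (con 1 :+ n)
                        := (t :* con 2 :+ n) :+ (n :* con 2 :+ con 1)) refl n t ⟩
    (t * 2 + n) + (n * 2 + 1)
      ≡⟨ cong (_+ (n * 2 + 1)) (triangle n) ⟩
    n * n + (n * 2 + 1)
      ≡⟨ solve 1 (λ n → n :* n :+ (n :* con 2 :+ con 1)
                      := (con 1 :+ n) :* (con 1 :+ n)) refl n ⟩
    suc n * suc n ∎
  where
  open ≡-Reasoning
  t = sumℕ n toℕ

triangle-odd : ∀ n m → n ≡ 1 + m * 2 → sumℕ n toℕ ≡ m * n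
triangle-odd n m n-odd =
  *-cancelʳ-≡ (sumℕ n toℕ) (m * n) 2 (+-cancelʳ-≡ n (sumℕ n toℕ * 2) (m * n * 2) doubled)
  where
  doubled : sumℕ n toℕ * 2 + n ≡ m * n * 2 + n
  doubled = trans (triangle n) (trans (cong (n *_) n-odd)
    (solve 2 (λ n m → n :* (con 1 :+ m :* con 2) := m :* n :* con 2 :+ n) refl n m))

module _ {N : ℕ} .{{_ : NonZero N}} where

  0ₘ : Fin N
  0ₘ = 0 mod N

  toℕ-0ₘ : toℕ 0ₘ ≡ 0
  toℕ-0ₘ = trans (toℕ-fromℕ< _) (m*n%n≡0 0 N)

  sumₘ : (n : ℕ) → (Fin n → Fin N) → Fin N
  sumₘ zero    g = 0ₘ
  sumₘ (suc n) g = g Fin.zero +ₘ sumₘ n (λ j → g (Fin.suc j))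

  +-%-absorbʳ : ∀ a s → (a + s % N) % N ≡ (a + s) % N
  +-%-absorbʳ a s = begin
    (a + s % N) % N          ≡⟨ %-distribˡ-+ a (s % N) N ⟩
    (a % N + s % N % N) % N  ≡⟨ cong (λ r → (a % N + r) % N) (m%n%n≡m%n s N) ⟩
    (a % N + s % N) % N      ≡⟨ sym (%-distribˡ-+ a s N) ⟩
    (a + s) % N              ∎
    where open ≡-Reasoning

  toℕ-sumₘ : ∀ n g → toℕ (sumₘ n g) ≡ sumℕ n (λ j → toℕ (g j)) % N
  toℕ-sumₘ zero    g = toℕ-fromℕ< _
  toℕ-sumₘ (suc n) g = begin
      toℕ ((a + toℕ (sumₘ n g′)) mod N)  ≡⟨ toℕ-fromℕ< _ ⟩
      (a + toℕ (sumₘ n g′)) % N          ≡⟨ cong (λ r → (a + r) % N) (toℕ-sumₘ n g′) ⟩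
      (a + s % N) % N                    ≡⟨ +-%-absorbʳ a s ⟩
      (a + s) % N                        ∎
    where
    open ≡-Reasoning
    a  = toℕ (g Fin.zero)
    g′ = λ j → g (Fin.suc j)
    s  = sumℕ n (λ j → toℕ (g′ j))

  multiple-of-N≡0ₘ : ∀ (x : Fin N) k → toℕ x ≡ k * N % N → x ≡ 0ₘ
  multiple-of-N≡0ₘ x k eq =
    toℕ-injective (trans eq (trans (m*n%n≡0 k N) (sym toℕ-0ₘ)))

  sumₘ-const : ∀ (i : Fin N) → sumₘ N (const i) ≡ 0ₘ
  sumₘ-const i = multiple-of-N≡0ₘ _ (toℕ i) (trans (toℕ-sumₘ N (const i))
    (cong (_% N) (trans (sumℕ-const N (toℕ i)) (*-comm N (toℕ i)))))

  sumₘ-id : N % 2 ≡ 1 → sumₘ N id ≡ 0ₘ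
  sumₘ-id N-odd = multiple-of-N≡0ₘ _ (N / 2) (trans (toℕ-sumₘ N id)
    (cong (_% N) (triangle-odd N (N / 2) N≡1+2m)))
    where
    N≡1+2m : N ≡ 1 + N / 2 * 2
    N≡1+2m = trans (m≡m%n+[m/n]*n N 2) (cong (_+ N / 2 * 2) N-odd)

module Homomorphism {c ℓ} (G : AbelianGroup c ℓ) {N : ℕ} .{{_ : NonZero N}}
    (φ : Fin N × Fin N → AbelianGroup.Carrier G)
    (hom : ∀ x y → AbelianGroup._≈_ G (φ (x +ₘ² y)) (AbelianGroup._∙_ G (φ x) (φ y))) where

  open AbelianGroup G
    using (_≈_; ε; reflexive; ∙-congˡ; group) renaming (sym to ≈-sym; trans to ≈-trans)
  open GroupProperties group using (identityˡ-unique)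

  0ₘ+0ₘ : 0ₘ +ₘ 0ₘ ≡ 0ₘ {N}
  0ₘ+0ₘ = toℕ-injective (begin
    toℕ (0ₘ +ₘ 0ₘ)             ≡⟨ toℕ-fromℕ< _ ⟩
    (toℕ 0ₘ + toℕ 0ₘ) % N      ≡⟨ cong (λ r → (r + r) % N) toℕ-0ₘ ⟩
    0 % N                      ≡⟨ toℕ-fromℕ< _ ⟨
    toℕ 0ₘ                     ∎)
    where open ≡-Reasoning

  -- φ(0) is idempotent, hence the identity.
  φ-zero : φ (0ₘ , 0ₘ) ≈ ε
  φ-zero = identityˡ-unique (φ o) (φ o)
    (≈-sym (≈-trans (reflexive (cong φ (sym (cong₂ _,_ 0ₘ+0ₘ 0ₘ+0ₘ)))) (hom o o)))
    where o = (0ₘ , 0ₘ)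

  φ-sum : ∀ n (x y : Fin n → Fin N) →
    sumG G n (λ j → φ (x j , y j)) ≈ φ (sumₘ n x , sumₘ n y)
  φ-sum zero    x y = ≈-sym φ-zero
  φ-sum (suc n) x y = ≈-trans (∙-congˡ (φ-sum n x′ y′))
    (≈-sym (hom (x Fin.zero , y Fin.zero) (sumₘ n x′ , sumₘ n y′)))
    where
    x′ = λ j → x (Fin.suc j)
    y′ = λ j → y (Fin.suc j)

mainTheorem5 : ∀ {c ℓ : Level} (G : AbelianGroup c ℓ) (N : ℕ) .{{_ : NonZero N}} →
    N % 2 ≡ 1 → TorsionIso G N → MagicGrid G N
mainTheorem5 G N N-odd iso = record
  { cell     = λ i j → φ (i , j)
  ; inG[N]   = λ i j → into (i , j)
  ; covers   = λ P P∈G[N] → let ((i , j) , φij≈P) = surj P P∈G[N] in i , j , φij≈P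
  ; distinct = λ i j k l φij≈φkl → let ij≡kl = inj (i , j) (k , l) φij≈φkl
                                   in cong proj₁ ij≡kl , cong proj₂ ij≡kl
  ; rowSum   = λ i → line-sum (sumₘ-const i) (sumₘ-id N-odd)
  ; colSum   = λ j → line-sum (sumₘ-id N-odd) (sumₘ-const j)
  }
  where
  open AbelianGroup G using (_≈_; ε; reflexive) renaming (trans to ≈-trans)
  open TorsionIso iso
  open Homomorphism G φ hom

  line-sum : ∀ {x y : Fin N → Fin N} → sumₘ N x ≡ 0ₘ → sumₘ N y ≡ 0ₘ →
    sumG G N (λ k → φ (x k , y k)) ≈ ε
  line-sum Σx≡0 Σy≡0 = ≈-trans (φ-sum N _ _)
    (≈-trans (reflexive (cong φ (cong₂ _,_ Σx≡0 Σy≡0))) φ-zero)
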